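{- Let $n\ge 0$ and use the sets $\mathcal{CP}'(n)=\mathcal{CP}'_o(n)\cup\mathcal{CP}'_e(n)$ and maps $f,g$ defined in the context. Then: (1) If $(\tilde\gamma,\tilde\sigma)\in\mathcal{CP}'_o(n)$, then $f((\tilde\gamma,\tilde\sigma))\in\mathcal{CP}'_e(n)$. (2) If $(\tilde\gamma,\tilde\sigma)\in\mathcal{CP}'_o(n)$ with $s(\tilde\sigma)<2\ell(\tilde\gamma)$, then $g((\tilde\gamma,\tilde\sigma))=(\tilde\gamma_g,\tilde\sigma_g)\in\mathcal{CP}'_e(n)$ and $\ell(\tilde\gamma_g)>\ell_e(\tilde\gamma_g)$. (3) If $(\tilde\gamma,\tilde\sigma)\in\mathcal{CP}'_e(n)$ and $\tilde\sigma$ is nonempty, then $g((\tilde\gamma,\tilde\sigma))\in\mathcal{CP}'_o(n)$. (4) If $(\tilde\gamma,\tilde\sigma)\in\mathcal{CP}'_e(n)$ with $\ell(\tilde\gamma)>\ell_e(\tilde\gamma)$, then $f((\tilde\gamma,\tilde\sigma))\in\mathcal{CP}'_o(n)$.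
   Context: Partitions are finite multisets of positive integers; parts of size $0$ are discarded. For a partition $\pi$: $\ell(\pi)$ is its largest part ($0$ if $\pi$ is empty); $\ell_e(\pi)$ is its largest even part ($0$ if $\pi$ has no even parts); $s(\pi)$ is its smallest part. $\mathcal{CP}'(n)$ is the set of pairs of partitions $(\tilde\gamma,\tilde\sigma)$ with $|\tilde\gamma|+|\tilde\sigma|=n$ such that all parts of $\tilde\sigma$ are odd, every part of $\tilde\sigma$ is at least $\ell(\tilde\gamma)+\ell_e(\tilde\gamma)$, and $\tilde\gamma$ satisfies one of the following: ($o$) the largest part $\ell(\tilde\gamma)$ is odd and is the only part size of $\tilde\gamma$ with odd multiplicity; ($e$) either $\tilde\gamma$ has an even part and $\ell_e(\tilde\gamma)$ is the only part size with odd multiplicity, or $\tilde\gamma$ has no even parts and every part size has even multiplicity (including $\tilde\gamma$ empty). $\mathcal{CP}'_o(n)$ consists of the pairs satisfying ($o$), $\mathcal{CP}'_e(n)$ of those satisfying ($e$). Define $o(\tilde\gamma)=\ell(\tilde\gamma)$ in case ($o$) and $o(\tilde\gamma)=\ell_e(\tilde\gamma)$ in case ($e$). For $(\tilde\gamma,\tilde\sigma)\in\mathcal{CP}'(n)$ with $\ell(\tilde\gamma)\neq\ell_e(\tilde\gamma)$, $f((\tilde\gamma,\tilde\sigma))=(\tilde\gamma_f,\tilde\sigma_f)$ is obtained by removing one copy of $\ell(\tilde\gamma)$ and one copy of $\ell_e(\tilde\gamma)$ from $\tilde\gamma$ (nothing is removed for a value $0$) and adding a part $\ell(\tilde\gamma)+\ell_e(\tilde\gamma)$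 to $\tilde\sigma$. For $(\tilde\gamma,\tilde\sigma)\in\mathcal{CP}'(n)$ with $\tilde\sigma$ nonempty, $g((\tilde\gamma,\tilde\sigma))=(\tilde\gamma_g,\tilde\sigma_g)$ is obtained by removing one copy of $s(\tilde\sigma)$ from $\tilde\sigma$ and adding to $\tilde\gamma$ the two parts $o(\tilde\gamma)$ and $s(\tilde\sigma)-o(\tilde\gamma)$ (parts equal to $0$ are not added). -}

module Defs where

open import Data.Nat using (ℕ; zero; suc; _+_; _∸_; _⊔_; _⊓_; _≤_; _<_; _≟_)
open import Data.Nat.Divisibility using (_∣_)
open import Data.List using (List; []; _∷_; foldr)
open import Data.Nat.ListAction using (sum)
open import Data.List.Relation.Unary.All using (All)
open import Data.Bool using (Bool; true; false; if_then_else_; _∧_)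
open import Data.Product using (_×_; _,_; proj₁; proj₂)
open import Data.Sum using (_⊎_)
open import Relation.Nullary using (¬_; does)
open import Relation.Binary.PropositionalEquality using (_≡_)

-- A partition is represented as a finite list of parts (order irrelevant:
-- every notion below is invariant under permutation of the list).
Partition : Set
Partition = List ℕ

Valid : Partition → Set
Valid π = All (λ x → 0 < x) π

Even : ℕ → Set
Even n = 2 ∣ n

Odd : ℕ → Set
Odd n = ¬ (2 ∣ n)

evenᵇ : ℕ → Bool
evenᵇ zero = true
evenᵇ (suc zero) = false
evenᵇ (suc (suc n)) = evenᵇ n

oddᵇ : ℕ → Bool
oddᵇ n = if evenᵇ n then false else true

mult : ℕ → Partition → ℕ
mult k [] = 0
mult k (x ∷ xs) = (if does (k ≟ x) then 1 else 0) + mult k xs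

ℓ : Partition → ℕ
ℓ = foldr _⊔_ 0

ℓe : Partition → ℕ
ℓe = foldr (λ x m → if evenᵇ x then x ⊔ m else m) 0

-- s(π): smallest part (only meaningful for nonempty π; 0 for empty)
s : Partition → ℕ
s [] = 0
s (x ∷ xs) = foldr _⊓_ x xs

removeOne : ℕ → Partition → Partition
removeOne zero π = π
removeOne (suc k) [] = []
removeOne (suc k) (x ∷ xs) = if does (suc k ≟ x) then xs else x ∷ removeOne (suc k) xs

addPart : ℕ → Partition → Partition
addPart zero π = π
addPart (suc k) π = suc k ∷ π

NonEmpty : Partition → Set
NonEmpty [] = Data.Empty.⊥ where import Data.Empty
NonEmpty (_ ∷ _) = Data.Unit.⊤ where import Data.Unit

CondO : Partition → Set
CondO γ = Odd (ℓ γ) × Odd (mult (ℓ γ) γ) × (∀ k → Odd (mult k γ) → k ≡ ℓ γ)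

CondE : Partition → Set
CondE γ =
  ((0 < ℓe γ) × Odd (mult (ℓe γ) γ) × (∀ k → Odd (mult k γ) → k ≡ ℓe γ))
  ⊎ (All Odd γ × (∀ k → Even (mult k γ)))

Base : ℕ → Partition × Partition → Set
Base n (γ , σ) =
  Valid γ × Valid σ × (sum γ + sum σ ≡ n) × All Odd σ × All (λ p → ℓ γ + ℓe γ ≤ p) σ

CP'o : ℕ → Partition × Partition → Set
CP'o n p = Base n p × CondO (proj₁ p)

CP'e : ℕ → Partition × Partition → Set
CP'e n p = Base n p × CondE (proj₁ p)

-- o(γ): ℓ(γ) in case (o), ℓ_e(γ) in case (e).  For γ satisfying (o) or (e),
-- case (o) holds exactly when ℓ(γ) is odd and has odd multiplicity.
o : Partition → ℕ
o γ = if oddᵇ (ℓ γ) ∧ oddᵇ (mult (ℓ γ) γ) then ℓ γ else ℓe γ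

f : Partition × Partition → Partition × Partition
f (γ , σ) = (removeOne (ℓe γ) (removeOne (ℓ γ) γ) , addPart (ℓ γ + ℓe γ) σ)

g : Partition × Partition → Partition × Partition
g (γ , σ) = (addPart (s σ ∸ o γ) (addPart (o γ) γ) , removeOne (s σ) σ)

-- Both f and g change γ only by adding or removing two parts: ℓ(γ) and
-- ℓe(γ) for f, o(γ) and s(σ) − o(γ) for g.  Modulo 2 this toggles the
-- multiplicities of exactly these two sizes, so the unique part size of odd
-- multiplicity moves from one of them to the other, which exchanges
-- conditions (o) and (e).  The parities (ℓ(γ) odd in case (o), ℓe(γ) even,
-- s(σ) odd) and the bound ℓ(γ) + ℓe(γ) ≤ s(σ) then determine the largest and
-- the largest even part of the new γ: for g their sum is exactly the part
-- s(σ) taken out of σ, for f it is at most the part ℓ(γ) + ℓe(γ) put into σ.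
module Submission where

open import Defs
open import Data.Bool using (true; false; T; _∧_; if_then_else_)
open import Data.Bool.Properties using (∧-conicalʳ)
open import Data.List using (List; []; _∷_; foldr; filterᵇ)
open import Data.List.Membership.Propositional using (_∈_)
open import Data.List.Membership.Propositional.Properties
  using (foldr-selective; ∈-filter⁺; ∈-filter⁻)
open import Data.List.Relation.Binary.Permutation.Propositional as ↭
  using (_↭_; ↭-refl; ↭-sym; ↭-trans)
open import Data.List.Relation.Binary.Permutation.Propositional.Properties using (∈-resp-↭)
open import Data.List.Relation.Binary.Subset.Propositional using (_⊆_)
open import Data.List.Relation.Unary.All as All using (All)
open import Data.List.Relation.Unary.Any using (here; there)
open import Data.Nat
  using (ℕ; zero; suc; _+_; _*_; _∸_; _⊔_; _⊓_; _≤_; _<_; _≟_; z≤n; z<s; parity)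
open import Data.Nat.Divisibility
  using (divides; _∣?_; ∣-refl; _∣0; ∣1⇒≡1; ∣m∣n⇒∣m+n; ∣m+n∣m⇒∣n)
open import Data.Nat.ListAction using (sum)
open import Data.Nat.ListAction.Properties using (sum-↭)
open import Data.Nat.Properties
open import Algebra.Properties.CommutativeSemigroup +-commutativeSemigroup
  using (x∙yz≈y∙xz; x∙yz≈yx∙z)
open import Data.Parity.Base as ℙ using (0ℙ; 1ℙ)
import Data.Parity.Properties as ℙ
open import Data.Product using (_×_; _,_; proj₁; proj₂; uncurry)
import Data.Product as Product
open import Data.Sum using (_⊎_; inj₁; inj₂; [_,_]′)
import Data.Sum as Sum
open import Function using (_∘_; id)
open import Relation.Nullary using (does; proof; yes; no; contradiction)
open import Relation.Nullary.Reflects using (ofʸ; ofⁿ)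
open import Relation.Nullary.Decidable using (dec-true; T?)
open import Relation.Binary.PropositionalEquality
  using (_≡_; _≢_; refl; sym; trans; cong; cong₂; subst; subst₂; module ≡-Reasoning)

open ≡-Reasoning

private
  variable
    a b k m n u x O : ℕ
    π π' γ γ' σ : Partition

-- Parity

even⇒parity≡0ℙ : Even n → parity n ≡ 0ℙ
even⇒parity≡0ℙ (divides q refl) = trans (ℙ.*-homo-* q 2) (ℙ.*-zeroʳ (parity q))

parity≡0ℙ⇒even : ∀ n → parity n ≡ 0ℙ → Even n
parity≡0ℙ⇒even zero          _ = 2 ∣0
parity≡0ℙ⇒even (suc zero)    ()
parity≡0ℙ⇒even (suc (suc n)) p = ∣m∣n⇒∣m+n ∣-refl (parity≡0ℙ⇒even n p)

odd⇒parity≡1ℙ : Odd n → parity n ≡ 1ℙ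
odd⇒parity≡1ℙ {n} odd with parity n in eq
... | 0ℙ = contradiction (parity≡0ℙ⇒even n eq) odd
... | 1ℙ = refl

parity≡1ℙ⇒odd : parity n ≡ 1ℙ → Odd n
parity≡1ℙ⇒odd p even with trans (sym (even⇒parity≡0ℙ even)) p
... | ()

odd⇒>0 : Odd n → 0 < n
odd⇒>0 {zero}  odd = contradiction (2 ∣0) odd
odd⇒>0 {suc n} _   = z<s

parity-∸ : n ≤ m → parity (m ∸ n) ≡ parity m ℙ.+ parity n
parity-∸ {n} {m} n≤m = ℙ.+-cancelʳ-≡ (parity n) _ _ (begin
  parity (m ∸ n) ℙ.+ parity n                ≡⟨ ℙ.+-homo-+ (m ∸ n) n ⟨
  parity (m ∸ n + n)                         ≡⟨ cong parity (m∸n+n≡m n≤m) ⟩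
  parity m                                   ≡⟨ ℙ.+-identityʳ (parity m) ⟨
  parity m ℙ.+ 0ℙ                            ≡⟨ cong (parity m ℙ.+_) (ℙ.p+p≡0ℙ (parity n)) ⟨
  parity m ℙ.+ (parity n ℙ.+ parity n)       ≡⟨ ℙ.+-assoc (parity m) (parity n) (parity n) ⟨
  (parity m ℙ.+ parity n) ℙ.+ parity n       ∎)

odd+even⇒odd : Odd m → Even n → Odd (m + n)
odd+even⇒odd {m} {n} odd even = parity≡1ℙ⇒odd (trans (ℙ.+-homo-+ m n)
  (cong₂ ℙ._+_ (odd⇒parity≡1ℙ odd) (even⇒parity≡0ℙ even)))

odd∸odd⇒even : n ≤ m → Odd m → Odd n → Even (m ∸ n)
odd∸odd⇒even n≤m oddm oddn = parity≡0ℙ⇒even _ (trans (parity-∸ n≤m)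
  (cong₂ ℙ._+_ (odd⇒parity≡1ℙ oddm) (odd⇒parity≡1ℙ oddn)))

odd∸even⇒odd : n ≤ m → Odd m → Even n → Odd (m ∸ n)
odd∸even⇒odd n≤m odd even = parity≡1ℙ⇒odd (trans (parity-∸ n≤m)
  (cong₂ ℙ._+_ (odd⇒parity≡1ℙ odd) (even⇒parity≡0ℙ even)))

evenᵇ⇒even : ∀ n → T (evenᵇ n) → Even n
evenᵇ⇒even zero          _ = 2 ∣0
evenᵇ⇒even (suc (suc n)) t = ∣m∣n⇒∣m+n ∣-refl (evenᵇ⇒even n t)

even⇒evenᵇ : ∀ n → Even n → T (evenᵇ n)
even⇒evenᵇ zero          _    = _
even⇒evenᵇ (suc zero)    2∣1  with ∣1⇒≡1 2∣1
... | ()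
even⇒evenᵇ (suc (suc n)) even = even⇒evenᵇ n (∣m+n∣m⇒∣n even ∣-refl)

odd⇒oddᵇ : Odd n → oddᵇ n ≡ true
odd⇒oddᵇ {n} odd with evenᵇ n in eq
... | true  = contradiction (evenᵇ⇒even n (subst T (sym eq) _)) odd
... | false = refl

oddᵇ⇒odd : oddᵇ n ≡ true → Odd n
oddᵇ⇒odd {n} t with evenᵇ n in eq
oddᵇ⇒odd {n} () | true
... | false = λ even → subst T eq (even⇒evenᵇ n even)

-- Adding and removing parts

_∈₀_ : ℕ → Partition → Set
m ∈₀ π = m ≡ 0 ⊎ m ∈ π

∈₀⇒∈ : 0 < m → m ∈₀ π → m ∈ π
∈₀⇒∈ ()  (inj₁ refl)
∈₀⇒∈ _   (inj₂ m∈π) = m∈π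

∈-addPart⁻ : x ∈ addPart m π → x ≡ m ⊎ x ∈ π
∈-addPart⁻ {m = zero}  x∈π        = inj₂ x∈π
∈-addPart⁻ {m = suc m} (here eq)  = inj₁ eq
∈-addPart⁻ {m = suc m} (there x∈π) = inj₂ x∈π

∈-addPart⁺ : x ∈ π → x ∈ addPart m π
∈-addPart⁺ {m = zero}  x∈π = x∈π
∈-addPart⁺ {m = suc m} x∈π = there x∈π

addPart-∈₀ : m ∈₀ addPart m π
addPart-∈₀ {zero}  = inj₁ refl
addPart-∈₀ {suc m} = inj₂ (here refl)

∈₀-addPart⁺ : ∀ m → x ∈₀ π → x ∈₀ addPart m π
∈₀-addPart⁺ m = Sum.map₂ (∈-addPart⁺ {m = m})

All-addPart : ∀ {P : ℕ → Set} → (0 < m → P m) → All P π → All P (addPart m π)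
All-addPart {zero}  _  ps = ps
All-addPart {suc m} pm ps = pm z<s All.∷ ps

sum-addPart : ∀ m π → sum (addPart m π) ≡ m + sum π
sum-addPart zero    π = refl
sum-addPart (suc m) π = refl

addPart⁺ : π ↭ π' → addPart m π ↭ addPart m π'
addPart⁺ {m = zero}  p = p
addPart⁺ {m = suc m} p = ↭.prep (suc m) p

addPart-comm : ∀ a b π → addPart a (addPart b π) ↭ addPart b (addPart a π)
addPart-comm zero    b       π = ↭-refl
addPart-comm (suc a) zero    π = ↭-refl
addPart-comm (suc a) (suc b) π = ↭.swap (suc a) (suc b) ↭-refl

addPart₂-↭⇒⊆ : ∀ a b → π ↭ addPart a (addPart b π') → π' ⊆ π
addPart₂-↭⇒⊆ a b π↭ = ∈-resp-↭ (↭-sym π↭) ∘ ∈-addPart⁺ {m = a} ∘ ∈-addPart⁺ {m = b}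

∈⇒removeOne-↭ : suc m ∈ π → π ↭ suc m ∷ removeOne (suc m) π
∈⇒removeOne-↭ {m} {x ∷ xs} m∈π with does (suc m ≟ x) | proof (suc m ≟ x) | m∈π
... | true  | ofʸ refl | _          = ↭-refl
... | false | ofⁿ m≢x  | here eq    = contradiction eq m≢x
... | false | ofⁿ _    | there m∈xs =
  ↭-trans (↭.prep x (∈⇒removeOne-↭ m∈xs)) (↭.swap x (suc m) ↭-refl)

removeOne-↭ : m ∈₀ π → π ↭ addPart m (removeOne m π)
removeOne-↭ {zero}  _          = ↭-refl
removeOne-↭ {suc m} (inj₂ m∈π) = ∈⇒removeOne-↭ m∈π

∈-removeOne⁺ : x ≢ m → x ∈ π → x ∈ removeOne m π
∈-removeOne⁺ {m = zero}  _ x∈π = x∈π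
∈-removeOne⁺ {m = suc m} {π = y ∷ ys} x≢m x∈π
  with does (suc m ≟ y) | proof (suc m ≟ y) | x∈π
... | true  | ofʸ refl | here x≡y   = contradiction x≡y x≢m
... | true  | ofʸ refl | there x∈ys = x∈ys
... | false | ofⁿ _    | here x≡y   = here x≡y
... | false | ofⁿ _    | there x∈ys = there (∈-removeOne⁺ x≢m x∈ys)

-- Multiplicities

δ : ℕ → ℕ → ℕ
δ k m = if does (k ≟ m) then 1 else 0

δ-refl : ∀ k → δ k k ≡ 1
δ-refl k = cong (λ c → if c then 1 else 0) (dec-true (k ≟ k) refl)

0<mult⇒∈ : 0 < mult k π → k ∈ π
0<mult⇒∈ {k} {x ∷ xs} pos with does (k ≟ x) | proof (k ≟ x)
... | true  | ofʸ k≡x = here k≡x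
... | false | ofⁿ _   = there (0<mult⇒∈ pos)

oddMult⇒∈ : Odd (mult k π) → k ∈ π
oddMult⇒∈ = 0<mult⇒∈ ∘ odd⇒>0

mult-↭ : π ↭ π' → mult k π ≡ mult k π'
mult-↭         ↭.refl         = refl
mult-↭ {k = k} (↭.prep x p)   = cong (δ k x +_) (mult-↭ p)
mult-↭ {k = k} (↭.swap x y p) = trans (cong (λ c → δ k x + (δ k y + c)) (mult-↭ p))
                                      (x∙yz≈y∙xz (δ k x) (δ k y) _)
mult-↭         (↭.trans p q)  = trans (mult-↭ p) (mult-↭ q)

mult-addPart : 0 < k → mult k (addPart m π) ≡ δ k m + mult k π
mult-addPart {suc k} {zero}  _ = refl
mult-addPart {k}     {suc m} _ = refl

parity-mult-addPart₂ : 0 < k →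
  parity (mult k (addPart a (addPart b π)))
    ≡ parity (δ k a) ℙ.+ (parity (δ k b) ℙ.+ parity (mult k π))
parity-mult-addPart₂ {k} {a} {b} {π} k>0 = begin
  parity (mult k (addPart a (addPart b π)))     ≡⟨ cong parity (mult-addPart k>0) ⟩
  parity (δ k a + mult k (addPart b π))         ≡⟨ ℙ.+-homo-+ (δ k a) _ ⟩
  A ℙ.+ parity (mult k (addPart b π))           ≡⟨ cong (λ c → A ℙ.+ parity c) (mult-addPart k>0) ⟩
  A ℙ.+ parity (δ k b + mult k π)               ≡⟨ cong (A ℙ.+_) (ℙ.+-homo-+ (δ k b) _) ⟩
  A ℙ.+ (parity (δ k b) ℙ.+ parity (mult k π))  ∎
  where
  A = parity (δ k a)

-- u is the only positive part size of odd multiplicity in γ; u = 0 means there is none.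
record SoleOddMult (γ : Partition) (u : ℕ) : Set where
  constructor mkSoleOddMult
  field
    parity-mult : ∀ {k} → 0 < k → parity (mult k γ) ≡ parity (δ k u)

open SoleOddMult

soleOddMult-intro : (∀ k → Odd (mult k γ) → k ≡ u) → (0 < u → Odd (mult u γ)) → SoleOddMult γ u
soleOddMult-intro {γ} {u} unique oddAt = mkSoleOddMult parity≡
  where
  parity≡ : 0 < k → parity (mult k γ) ≡ parity (δ k u)
  parity≡ {k} k>0 with does (k ≟ u) | proof (k ≟ u)
  ... | true  | ofʸ refl = odd⇒parity≡1ℙ (oddAt k>0)
  ... | false | ofⁿ k≢u with 2 ∣? mult k γ
  ...   | yes even = even⇒parity≡0ℙ even
  ...   | no odd   = contradiction (unique k odd) k≢u

soleOddMult-oddAt : SoleOddMult γ u → 0 < u → Odd (mult u γ)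
soleOddMult-oddAt {u = u} sole u>0 =
  parity≡1ℙ⇒odd (trans (parity-mult sole u>0) (cong parity (δ-refl u)))

soleOddMult-unique : Valid γ → SoleOddMult γ u → ∀ k → Odd (mult k γ) → k ≡ u
soleOddMult-unique {γ} {u} valid sole k odd
  with does (k ≟ u) | proof (k ≟ u) | parity-mult sole (All.lookup valid (oddMult⇒∈ odd))
... | true  | ofʸ k≡u | _       = k≡u
... | false | ofⁿ _   | parity≡ = contradiction (parity≡0ℙ⇒even _ parity≡) odd

soleOddMult-∈₀ : SoleOddMult γ u → u ∈₀ γ
soleOddMult-∈₀ {u = zero}  _    = inj₁ refl
soleOddMult-∈₀ {u = suc u} sole = inj₂ (oddMult⇒∈ (soleOddMult-oddAt sole z<s))

soleOddMult-removed : γ ↭ addPart a (addPart b γ') → SoleOddMult γ a → SoleOddMult γ' b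
soleOddMult-removed {γ} {a} {b} {γ'} γ↭ sole = mkSoleOddMult λ {k} k>0 →
  let A = parity (δ k a)
      B = parity (δ k b)
  in ℙ.+-cancelˡ-≡ B _ _ (ℙ.+-cancelˡ-≡ A _ _ (begin
    A ℙ.+ (B ℙ.+ parity (mult k γ'))                   ≡⟨ parity-mult-addPart₂ k>0 ⟨
    parity (mult k (addPart a (addPart b γ')))         ≡⟨ cong parity (mult-↭ γ↭) ⟨
    parity (mult k γ)                                  ≡⟨ parity-mult sole k>0 ⟩
    A                                                  ≡⟨ ℙ.+-identityʳ A ⟨
    A ℙ.+ 0ℙ                                           ≡⟨ cong (A ℙ.+_) (ℙ.p+p≡0ℙ B) ⟨
    A ℙ.+ (B ℙ.+ B)                                    ∎))

soleOddMult-added : SoleOddMult γ b → SoleOddMult (addPart a (addPart b γ)) a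
soleOddMult-added {γ} {b} {a} sole = mkSoleOddMult λ {k} k>0 →
  let A = parity (δ k a)
      B = parity (δ k b)
  in begin
  parity (mult k (addPart a (addPart b γ)))   ≡⟨ parity-mult-addPart₂ k>0 ⟩
  A ℙ.+ (B ℙ.+ parity (mult k γ))             ≡⟨ cong (λ p → A ℙ.+ (B ℙ.+ p)) (parity-mult sole k>0) ⟩
  A ℙ.+ (B ℙ.+ B)                             ≡⟨ cong (A ℙ.+_) (ℙ.p+p≡0ℙ B) ⟩
  A ℙ.+ 0ℙ                                    ≡⟨ ℙ.+-identityʳ A ⟩
  A                                           ∎

-- Largest part, largest even part, smallest part

ℓ-∈₀ : ∀ π → ℓ π ∈₀ π
ℓ-∈₀ = foldr-selective ⊔-sel 0

∈⇒≤ℓ : x ∈ π → x ≤ ℓ π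
∈⇒≤ℓ {π = y ∷ ys} (here refl) = m≤m⊔n y (ℓ ys)
∈⇒≤ℓ {π = y ∷ ys} (there x∈ys) = ≤-trans (∈⇒≤ℓ x∈ys) (m≤n⊔m y (ℓ ys))

∈₀⇒≤ℓ : x ∈₀ π → x ≤ ℓ π
∈₀⇒≤ℓ (inj₁ refl) = z≤n
∈₀⇒≤ℓ (inj₂ x∈π)  = ∈⇒≤ℓ x∈π

ℓ≤ : (∀ {x} → x ∈ π → x ≤ m) → ℓ π ≤ m
ℓ≤ {π} bound = [ (λ ℓ≡0 → ≤-trans (≤-reflexive ℓ≡0) z≤n) , bound ]′ (ℓ-∈₀ π)

ℓ-mono : π' ⊆ π → ℓ π' ≤ ℓ π
ℓ-mono π'⊆π = ℓ≤ (∈⇒≤ℓ ∘ π'⊆π)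

evens : Partition → Partition
evens = filterᵇ evenᵇ

ℓe≡ℓ∘evens : ∀ π → ℓe π ≡ ℓ (evens π)
ℓe≡ℓ∘evens []       = refl
ℓe≡ℓ∘evens (x ∷ xs) with evenᵇ x
... | true  = cong (x ⊔_) (ℓe≡ℓ∘evens xs)
... | false = ℓe≡ℓ∘evens xs

∈-evens⁺ : x ∈ π → Even x → x ∈ evens π
∈-evens⁺ {x} x∈π even = ∈-filter⁺ (T? ∘ evenᵇ) x∈π (even⇒evenᵇ x even)

∈-evens⁻ : x ∈ evens π → x ∈ π × Even x
∈-evens⁻ {x} x∈ = Product.map₂ (evenᵇ⇒even x) (∈-filter⁻ (T? ∘ evenᵇ) x∈)

ℓe-∈₀-evens : ∀ π → ℓe π ∈₀ evens π
ℓe-∈₀-evens π = subst (_∈₀ evens π) (sym (ℓe≡ℓ∘evens π)) (ℓ-∈₀ (evens π))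

ℓe-∈₀ : ∀ π → ℓe π ∈₀ π
ℓe-∈₀ π = Sum.map₂ (proj₁ ∘ ∈-evens⁻ {π = π}) (ℓe-∈₀-evens π)

ℓe-even : ∀ π → Even (ℓe π)
ℓe-even π =
  [ (λ ℓe≡0 → subst Even (sym ℓe≡0) (2 ∣0)) , proj₂ ∘ ∈-evens⁻ {π = π} ]′ (ℓe-∈₀-evens π)

∈₀⇒≤ℓe : x ∈₀ π → Even x → x ≤ ℓe π
∈₀⇒≤ℓe {π = π} x∈₀π even =
  subst (_ ≤_) (sym (ℓe≡ℓ∘evens π)) (∈₀⇒≤ℓ (Sum.map₂ (λ x∈π → ∈-evens⁺ x∈π even) x∈₀π))

ℓe≤ : (∀ {x} → x ∈ π → Even x → x ≤ m) → ℓe π ≤ m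
ℓe≤ {π} bound = subst (_≤ _) (sym (ℓe≡ℓ∘evens π)) (ℓ≤ (uncurry bound ∘ ∈-evens⁻ {π = π}))

ℓe-mono : π' ⊆ π → ℓe π' ≤ ℓe π
ℓe-mono {π'} π'⊆π = ℓe≤ {π'} (λ x∈π' even → ∈₀⇒≤ℓe (inj₂ (π'⊆π x∈π')) even)

ℓe≤ℓ : ∀ π → ℓe π ≤ ℓ π
ℓe≤ℓ π = ℓe≤ {π} (λ x∈π _ → ∈⇒≤ℓ x∈π)

s-∈ : NonEmpty π → s π ∈ π
s-∈ {x ∷ xs} _ = [ here , there ]′ (foldr-selective ⊓-sel x xs)

foldr-⊓≤ : ∀ e xs → x ∈ e ∷ xs → foldr _⊓_ e xs ≤ x
foldr-⊓≤ e []       (here refl)         = ≤-refl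
foldr-⊓≤ e (z ∷ zs) (here refl)         = ≤-trans (m⊓n≤n z _) (foldr-⊓≤ e zs (here refl))
foldr-⊓≤ e (z ∷ zs) (there (here refl)) = m⊓n≤m z _
foldr-⊓≤ e (z ∷ zs) (there (there x∈))  = ≤-trans (m⊓n≤n z _) (foldr-⊓≤ e zs (there x∈))

s≤ : x ∈ π → s π ≤ x
s≤ {π = y ∷ ys} = foldr-⊓≤ y ys

-- Conditions (o) and (e)

condO⇒soleOddMult : CondO γ → SoleOddMult γ (ℓ γ)
condO⇒soleOddMult (_ , oddMult , unique) = soleOddMult-intro unique (λ _ → oddMult)

soleOddMult⇒condO : Valid γ → ℓ γ ≡ u → Odd u → SoleOddMult γ u → CondO γ
soleOddMult⇒condO valid refl oddℓ sole =
  oddℓ , soleOddMult-oddAt sole (odd⇒>0 oddℓ) , soleOddMult-unique valid sole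

condE⇒soleOddMult : CondE γ → SoleOddMult γ (ℓe γ)
condE⇒soleOddMult (inj₁ (_ , oddMult , unique)) = soleOddMult-intro unique (λ _ → oddMult)
condE⇒soleOddMult {γ} (inj₂ (allOdd , allEven)) =
  soleOddMult-intro (λ k odd → contradiction (allEven k) odd) noEvenPart
  where
  noEvenPart : 0 < ℓe γ → Odd (mult (ℓe γ) γ)
  noEvenPart ℓe>0 = contradiction (ℓe-even γ) (All.lookup allOdd (∈₀⇒∈ ℓe>0 (ℓe-∈₀ γ)))

soleOddMult⇒condE : Valid γ → ℓe γ ≡ u → SoleOddMult γ u → CondE γ
soleOddMult⇒condE {γ} valid refl sole with ℓe-∈₀ γ
... | inj₂ ℓe∈γ = inj₁ (ℓe>0 , soleOddMult-oddAt sole ℓe>0 , soleOddMult-unique valid sole)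
  where ℓe>0 = All.lookup valid ℓe∈γ
... | inj₁ ℓe≡0 = inj₂ (All.tabulate partOdd , multEven)
  where
  partOdd : x ∈ γ → Odd x
  partOdd x∈γ even =
    <⇒≱ (All.lookup valid x∈γ) (≤-trans (∈₀⇒≤ℓe (inj₂ x∈γ) even) (≤-reflexive ℓe≡0))
  multEven : ∀ k → Even (mult k γ)
  multEven k with 2 ∣? mult k γ
  ... | yes even = even
  ... | no odd   = contradiction (trans (soleOddMult-unique valid sole k odd) ℓe≡0)
                                 (n>0⇒n≢0 (All.lookup valid (oddMult⇒∈ odd)))

o-condO : CondO γ → o γ ≡ ℓ γ
o-condO {γ} (oddℓ , oddMult , _) =
  cong₂ (λ p q → if p ∧ q then ℓ γ else ℓe γ) (odd⇒oddᵇ oddℓ) (odd⇒oddᵇ oddMult)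

o-condE : Valid γ → CondE γ → o γ ≡ ℓe γ
o-condE {γ} valid condE with oddᵇ (ℓ γ) ∧ oddᵇ (mult (ℓ γ) γ) in eq
... | true  =
  soleOddMult-unique valid (condE⇒soleOddMult {γ} condE) (ℓ γ) (oddᵇ⇒odd (∧-conicalʳ _ _ eq))
... | false = refl

-- The map f

f-↭ : Odd (ℓ γ) → ℓ γ ∈ γ →
      γ ↭ addPart (ℓ γ) (addPart (ℓe γ) (removeOne (ℓe γ) (removeOne (ℓ γ) γ)))
f-↭ {γ} oddℓ ℓ∈γ = ↭-trans (removeOne-↭ (inj₂ ℓ∈γ)) (addPart⁺ (removeOne-↭ ℓe∈₀γ₁))
  where
  ℓe≢ℓ : ℓe γ ≢ ℓ γ
  ℓe≢ℓ ℓe≡ℓ = oddℓ (subst Even ℓe≡ℓ (ℓe-even γ))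
  ℓe∈₀γ₁ : ℓe γ ∈₀ removeOne (ℓ γ) γ
  ℓe∈₀γ₁ = Sum.map₂ (∈-removeOne⁺ ℓe≢ℓ) (ℓe-∈₀ γ)

f-base : Base n (γ , σ) → γ ↭ addPart (ℓ γ) (addPart (ℓe γ) γ') → Odd (ℓ γ + ℓe γ) →
         Base n (γ' , addPart (ℓ γ + ℓe γ) σ)
f-base {n} {γ} {σ} {γ'} (validγ , validσ , total , oddσ , boundσ) γ↭ odd =
  All.tabulate (All.lookup validγ ∘ γ'⊆γ) ,
  All-addPart (λ _ → odd⇒>0 odd) validσ ,
  total' ,
  All-addPart (λ _ → odd) oddσ ,
  All-addPart (λ _ → bound) (All.map (≤-trans bound) boundσ)
  where
  L = ℓ γ
  E = ℓe γ
  γ'⊆γ : γ' ⊆ γ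
  γ'⊆γ = addPart₂-↭⇒⊆ L E γ↭
  bound : ℓ γ' + ℓe γ' ≤ L + E
  bound = +-mono-≤ (ℓ-mono γ'⊆γ) (ℓe-mono γ'⊆γ)
  total' : sum γ' + sum (addPart (L + E) σ) ≡ n
  total' = begin
    sum γ' + sum (addPart (L + E) σ)    ≡⟨ cong (sum γ' +_) (sum-addPart (L + E) σ) ⟩
    sum γ' + (L + E + sum σ)            ≡⟨ x∙yz≈yx∙z (sum γ') (L + E) (sum σ) ⟩
    (L + E + sum γ') + sum σ            ≡⟨ cong (_+ sum σ) (+-assoc L E (sum γ')) ⟩
    L + (E + sum γ') + sum σ            ≡⟨ cong (λ c → L + c + sum σ) (sum-addPart E γ') ⟨
    L + sum (addPart E γ') + sum σ      ≡⟨ cong (_+ sum σ) (sum-addPart L (addPart E γ')) ⟨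
    sum (addPart L (addPart E γ')) + sum σ ≡⟨ cong (_+ sum σ) (sum-↭ γ↭) ⟨
    sum γ + sum σ                       ≡⟨ total ⟩
    n                                   ∎

f-on-CP'o : CP'o n (γ , σ) → CP'e n (f (γ , σ))
f-on-CP'o {n} {γ} {σ} (base , condO@(oddℓ , oddMult , _)) =
  base' , soleOddMult⇒condE (proj₁ base') ℓe-γf sole'
  where
  γf = proj₁ (f (γ , σ))
  γ↭ = f-↭ oddℓ (oddMult⇒∈ oddMult)
  base' = f-base base γ↭ (odd+even⇒odd oddℓ (ℓe-even γ))
  sole' : SoleOddMult γf (ℓe γ)
  sole' = soleOddMult-removed γ↭ (condO⇒soleOddMult {γ} condO)
  ℓe-γf : ℓe γf ≡ ℓe γ
  ℓe-γf = ≤-antisym (ℓe-mono (addPart₂-↭⇒⊆ (ℓ γ) (ℓe γ) γ↭))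
                    (∈₀⇒≤ℓe (soleOddMult-∈₀ sole') (ℓe-even γ))

f-on-CP'e : CP'e n (γ , σ) → ℓe γ < ℓ γ → CP'o n (f (γ , σ))
f-on-CP'e {n} {γ} {σ} (base , condE) ℓe<ℓ =
  base' , soleOddMult⇒condO (proj₁ base') ℓ-γf oddℓ sole'
  where
  γf = proj₁ (f (γ , σ))
  ℓ∈γ : ℓ γ ∈ γ
  ℓ∈γ = ∈₀⇒∈ (m<n⇒0<n ℓe<ℓ) (ℓ-∈₀ γ)
  oddℓ : Odd (ℓ γ)
  oddℓ even = <⇒≱ ℓe<ℓ (∈₀⇒≤ℓe (inj₂ ℓ∈γ) even)
  γ↭ = f-↭ oddℓ ℓ∈γ
  base' = f-base base γ↭ (odd+even⇒odd oddℓ (ℓe-even γ))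
  sole' : SoleOddMult γf (ℓ γ)
  sole' = soleOddMult-removed (↭-trans γ↭ (addPart-comm (ℓ γ) (ℓe γ) γf))
                              (condE⇒soleOddMult {γ} condE)
  ℓ-γf : ℓ γf ≡ ℓ γ
  ℓ-γf = ≤-antisym (ℓ-mono (addPart₂-↭⇒⊆ (ℓ γ) (ℓe γ) γ↭)) (∈₀⇒≤ℓ (soleOddMult-∈₀ sole'))

-- The map g

addSplit : ℕ → ℕ → Partition → Partition
addSplit O S γ = addPart (S ∸ O) (addPart O γ)

∈-addSplit⁻ : ∀ O m → x ∈ addSplit O m γ → x ≡ m ∸ O ⊎ x ≡ O ⊎ x ∈ γ
∈-addSplit⁻ O m = Sum.map₂ (∈-addPart⁻ {m = O}) ∘ ∈-addPart⁻ {m = m ∸ O}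

sum-addSplit : O ≤ m → sum (addSplit O m γ) ≡ m + sum γ
sum-addSplit {O} {m} {γ} O≤m = begin
  sum (addPart (m ∸ O) (addPart O γ))   ≡⟨ sum-addPart (m ∸ O) (addPart O γ) ⟩
  m ∸ O + sum (addPart O γ)             ≡⟨ cong (m ∸ O +_) (sum-addPart O γ) ⟩
  m ∸ O + (O + sum γ)                   ≡⟨ +-assoc (m ∸ O) O (sum γ) ⟨
  m ∸ O + O + sum γ                     ≡⟨ cong (_+ sum γ) (m∸n+n≡m O≤m) ⟩
  m + sum γ                             ∎

g-base : Base n (γ , σ) → NonEmpty σ → O ≤ s σ →
         ℓ (addSplit O (s σ) γ) + ℓe (addSplit O (s σ) γ) ≤ s σ →
         Base n (addSplit O (s σ) γ , removeOne (s σ) σ)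
g-base {n} {γ} {σ} {O} (validγ , validσ , total , oddσ , boundσ) nonEmpty O≤S bound =
  All-addPart {s σ ∸ O} id (All-addPart {O} id validγ) ,
  All.tabulate (All.lookup validσ ∘ σ'⊆σ) ,
  total' ,
  All.tabulate (All.lookup oddσ ∘ σ'⊆σ) ,
  All.tabulate (λ x∈σ' → ≤-trans bound (s≤ (σ'⊆σ x∈σ')))
  where
  S = s σ
  σ' = removeOne S σ
  σ↭ : σ ↭ addPart S σ'
  σ↭ = removeOne-↭ (inj₂ (s-∈ nonEmpty))
  σ'⊆σ : σ' ⊆ σ
  σ'⊆σ = ∈-resp-↭ (↭-sym σ↭) ∘ ∈-addPart⁺
  total' : sum (addSplit O S γ) + sum σ' ≡ n
  total' = begin
    sum (addSplit O S γ) + sum σ'   ≡⟨ cong (_+ sum σ') (sum-addSplit O≤S) ⟩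
    S + sum γ + sum σ'              ≡⟨ x∙yz≈yx∙z (sum γ) S (sum σ') ⟨
    sum γ + (S + sum σ')            ≡⟨ cong (sum γ +_) (sum-addPart S σ') ⟨
    sum γ + sum (addPart S σ')      ≡⟨ cong (sum γ +_) (sum-↭ σ↭) ⟨
    sum γ + sum σ                   ≡⟨ total ⟩
    n                               ∎

g-on-CP'o : O ≡ ℓ γ → CP'o n (γ , σ) → NonEmpty σ → s σ < 2 * ℓ γ →
            CP'e n (addSplit O (s σ) γ , removeOne (s σ) σ) ×
            ℓe (addSplit O (s σ) γ) < ℓ (addSplit O (s σ) γ)
g-on-CP'o {γ = γ} {σ = σ} refl (base@(_ , _ , _ , oddσ , boundσ) , condO@(oddL , _))
          nonEmpty S<2L =
  (base' , soleOddMult⇒condE (proj₁ base') ℓe-γg sole') ,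
  subst₂ _<_ (sym ℓe-γg) (sym ℓ-γg) D<L
  where
  L = ℓ γ
  E = ℓe γ
  S = s σ
  D = S ∸ L
  γg = addSplit L S γ
  L+E≤S : L + E ≤ S
  L+E≤S = All.lookup boundσ (s-∈ nonEmpty)
  L≤S : L ≤ S
  L≤S = m+n≤o⇒m≤o L L+E≤S
  L+D≡S : L + D ≡ S
  L+D≡S = m+[n∸m]≡n L≤S
  D<L : D < L
  D<L = +-cancelˡ-< L D L (subst₂ _<_ (sym L+D≡S) (cong (L +_) (+-identityʳ L)) S<2L)
  E≤D : E ≤ D
  E≤D = m+n≤o⇒m≤o∸n E (subst (_≤ S) (+-comm L E) L+E≤S)
  evenD : Even D
  evenD = odd∸odd⇒even L≤S (All.lookup oddσ (s-∈ nonEmpty)) oddL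
  sole' : SoleOddMult γg D
  sole' = soleOddMult-added {a = D} (condO⇒soleOddMult {γ} condO)
  ℓ-γg : ℓ γg ≡ L
  ℓ-γg = ≤-antisym (ℓ≤ bound) (∈₀⇒≤ℓ {π = γg} (∈₀-addPart⁺ D (addPart-∈₀ {L} {γ})))
    where
    bound : x ∈ γg → x ≤ L
    bound x∈ with ∈-addSplit⁻ L S x∈
    ... | inj₁ refl        = <⇒≤ D<L
    ... | inj₂ (inj₁ refl) = ≤-refl
    ... | inj₂ (inj₂ x∈γ)  = ∈⇒≤ℓ x∈γ
  ℓe-γg : ℓe γg ≡ D
  ℓe-γg = ≤-antisym (ℓe≤ {γg} boundE) (∈₀⇒≤ℓe {π = γg} addPart-∈₀ evenD)
    where
    boundE : x ∈ γg → Even x → x ≤ D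
    boundE x∈ even with ∈-addSplit⁻ L S x∈
    ... | inj₁ refl        = ≤-refl
    ... | inj₂ (inj₁ refl) = contradiction even oddL
    ... | inj₂ (inj₂ x∈γ)  = ≤-trans (∈₀⇒≤ℓe (inj₂ x∈γ) even) E≤D
  base' = g-base base nonEmpty L≤S (≤-reflexive (trans (cong₂ _+_ ℓ-γg ℓe-γg) L+D≡S))

g-on-CP'e : O ≡ ℓe γ → CP'e n (γ , σ) → NonEmpty σ →
            CP'o n (addSplit O (s σ) γ , removeOne (s σ) σ)
g-on-CP'e {γ = γ} {σ = σ} refl (base@(_ , _ , _ , oddσ , boundσ) , condE) nonEmpty =
  base' , soleOddMult⇒condO (proj₁ base') ℓ-γg oddD sole'
  where
  L = ℓ γ
  E = ℓe γ
  S = s σ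
  D = S ∸ E
  γg = addSplit E S γ
  L+E≤S : L + E ≤ S
  L+E≤S = All.lookup boundσ (s-∈ nonEmpty)
  E≤S : E ≤ S
  E≤S = m+n≤o⇒n≤o L L+E≤S
  L≤D : L ≤ D
  L≤D = m+n≤o⇒m≤o∸n L L+E≤S
  oddD : Odd D
  oddD = odd∸even⇒odd E≤S (All.lookup oddσ (s-∈ nonEmpty)) (ℓe-even γ)
  sole' : SoleOddMult γg D
  sole' = soleOddMult-added {a = D} (condE⇒soleOddMult {γ} condE)
  ℓ-γg : ℓ γg ≡ D
  ℓ-γg = ≤-antisym (ℓ≤ bound) (∈₀⇒≤ℓ {π = γg} addPart-∈₀)
    where
    bound : x ∈ γg → x ≤ D
    bound x∈ with ∈-addSplit⁻ E S x∈
    ... | inj₁ refl        = ≤-refl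
    ... | inj₂ (inj₁ refl) = ≤-trans (ℓe≤ℓ γ) L≤D
    ... | inj₂ (inj₂ x∈γ)  = ≤-trans (∈⇒≤ℓ x∈γ) L≤D
  ℓe-γg : ℓe γg ≡ E
  ℓe-γg = ≤-antisym (ℓe≤ {γg} boundE)
                    (∈₀⇒≤ℓe {π = γg} (∈₀-addPart⁺ D (addPart-∈₀ {E} {γ})) (ℓe-even γ))
    where
    boundE : x ∈ γg → Even x → x ≤ E
    boundE x∈ even with ∈-addSplit⁻ E S x∈
    ... | inj₁ refl        = contradiction even oddD
    ... | inj₂ (inj₁ refl) = ≤-refl
    ... | inj₂ (inj₂ x∈γ)  = ∈₀⇒≤ℓe (inj₂ x∈γ) even
  base' = g-base base nonEmpty E≤S
    (≤-reflexive (trans (cong₂ _+_ ℓ-γg ℓe-γg) (trans (+-comm D E) (m+[n∸m]≡n E≤S))))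

lemma1 : (n : ℕ) (γ σ : List ℕ) →
    (CP'o n (γ , σ) → CP'e n (f (γ , σ)))
    × (CP'o n (γ , σ) → NonEmpty σ → s σ < 2 * ℓ γ →
         CP'e n (g (γ , σ)) × ℓe (proj₁ (g (γ , σ))) < ℓ (proj₁ (g (γ , σ))))
    × (CP'e n (γ , σ) → NonEmpty σ → CP'o n (g (γ , σ)))
    × (CP'e n (γ , σ) → ℓe γ < ℓ γ → CP'o n (f (γ , σ)))
lemma1 n γ σ =
    f-on-CP'o
  , (λ cp → g-on-CP'o (o-condO {γ} (proj₂ cp)) cp)
  , (λ cp → g-on-CP'e (o-condE {γ} (proj₁ (proj₁ cp)) (proj₂ cp)) cp)
  , f-on-CP'e
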